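{- Let $\alpha_1,\alpha_2,\dots,\alpha_m\in[n]^k$ be distinct positions. For a uniformly random $A\in L_n^k$, \[\Pr\left[f_A(\alpha_1)<f_A(\alpha_2)<\dots<f_A(\alpha_m)\right]\le\frac{1}{m!}.\]
   Context: An order-$n$ $k$-dimensional permutation is an array $A:[n]^{k+1}\to\{0,1\}$ such that every line contains exactly one $1$, where a line is the set of positions obtained by fixing $k$ of the $k+1$ coordinates and letting the remaining coordinate range over $[n]$; $L_n^k$ is the set of these. For $\alpha\in[n]^k$, $f_A(\alpha)$ is the unique $t\in[n]$ with $A(\alpha,t)=1$. -}

module Defs where

open import Data.Nat using (ℕ; zero; suc; _+_; _≡ᵇ_; _<ᵇ_)
open import Data.Bool using (Bool; true; false; if_then_else_; _∧_)
open import Data.Fin using (Fin; toℕ)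
open import Data.List using (List; []; _∷_; map; concatMap; filterᵇ; length; allFin; foldr)
open import Data.Vec using (Vec; []; _∷_; lookup; _[_]≔_; _∷ʳ_)
open import Data.Nat.ListAction using (sum)
open import Data.Bool.ListAction using (and)
open import Data.Maybe using (Maybe; just; nothing)

-- A d-dimensional array over [n] with 0/1 entries (Bool; true = 1),
-- stored as nested vectors so that the set of all arrays is a finite,
-- explicitly enumerable set.
Tensor : ℕ → ℕ → Set
Tensor n zero    = Bool
Tensor n (suc d) = Vec (Tensor n d) n

at : ∀ {n d} → Tensor n d → Vec (Fin n) d → Bool
at {d = zero}  b       []       = b
at {d = suc d} xs (i ∷ p) = at (lookup xs i) p

all : ∀ {A : Set} → (A → Bool) → List A → Bool
all p xs = and (map p xs)

vecsOver : ∀ {A : Set} → List A → (l : ℕ) → List (Vec A l)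
vecsOver xs zero    = [] ∷ []
vecsOver xs (suc l) = concatMap (λ x → map (x ∷_) (vecsOver xs l)) xs

positions : (n d : ℕ) → List (Vec (Fin n) d)
positions n d = vecsOver (allFin n) d

allTensors : (n d : ℕ) → List (Tensor n d)
allTensors n zero    = true ∷ false ∷ []
allTensors n (suc d) = vecsOver (allTensors n d) n

lineCount : ∀ {n d} → Tensor n d → Vec (Fin n) d → Fin d → ℕ
lineCount {n} A p j = sum (map (λ t → if at A (p [ j ]≔ t) then 1 else 0) (allFin n))

isPerm : ∀ {n} k → Tensor n (suc k) → Bool
isPerm {n} k A =
  all (λ p → all (λ j → lineCount A p j ≡ᵇ 1) (allFin (suc k))) (positions n (suc k))

L : (n k : ℕ) → List (Tensor n (suc k))
L n k = filterᵇ (isPerm k) (allTensors n (suc k))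

-- f_A(α): the (first, and for A ∈ L_n^k unique) t with A(α,t) = 1
f : ∀ {n k} → Tensor n (suc k) → Vec (Fin n) k → Maybe (Fin n)
f {n} A α = foldr (λ t r → if at A (α ∷ʳ t) then just t else r) nothing (allFin n)

ltM : ∀ {n} → Maybe (Fin n) → Maybe (Fin n) → Bool
ltM (just a) (just b) = toℕ a <ᵇ toℕ b
ltM _ _ = false

-- the event f_A(α_1) < f_A(α_2) < ... < f_A(α_m)
-- (stated for all pairs i < j, equivalent to the chain by transitivity)
increasing : ∀ {n k m} → (Fin m → Vec (Fin n) k) → Tensor n (suc k) → Bool
increasing {m = m} α A =
  all (λ i → all (λ j → if toℕ i <ᵇ toℕ j then ltM (f A (α i)) (f A (α j)) else true)
                 (allFin m)) (allFin m)

-- Relabelling the symbols of the last coordinate by a permutation π of [n] maps L_n^k to itself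
-- and turns every value f_A(β) into π (f_A(β)). If f_A(γ₁) < … < f_A(γₘ), relabelling by the
-- transposition of the two values at γᵢ and γⱼ gives an array on which γ with γᵢ and γⱼ exchanged
-- is increasing; those two values can be read off the new array, so the map is injective and
-- exchanging two positions never decreases the count. Now split the arrays on which
-- f_A(α₂) < … < f_A(αₘ) according to the place r at which f_A(α₁) fits into this chain: the m
-- classes are disjoint, class 0 is the event for α, and class r+1 arises from class r by exchanging
-- two adjacent positions. Hence m · #{f_A(α₁) < … < f_A(αₘ)} ≤ #{f_A(α₂) < … < f_A(αₘ)}, and
-- induction on m gives the factor m!.

module Submission where

open import Defs
open import Data.Nat using (ℕ; zero; suc; _+_; _*_; _≤_; _!; z≤n; s≤s; _<ᵇ_) renaming (_<_ to _<ℕ_)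
import Data.Nat.Properties as ℕ
open import Data.Nat.ListAction using (sum)
open import Data.Bool using (Bool; true; false; T; if_then_else_)
open import Data.Empty using (⊥; ⊥-elim)
open import Data.Unit using (tt)
open import Data.Fin using (Fin; zero; suc; toℕ; fromℕ; fromℕ<; inject₁; punchIn; _<_)
open import Data.Fin.Properties using (_≟_)
import Data.Fin.Properties as Fin
open import Data.Fin.Induction using (<-weakInduction)
open import Data.Fin.Permutation
  using (Permutation; _⟨$⟩ʳ_; _⟨$⟩ˡ_; inverseˡ; inverseʳ; flip; transpose; lift₀-transpose) renaming (id to idₚ)
import Data.Fin.Permutation.Components as PC
open import Data.Vec using (Vec; []; _∷_; lookup; tabulate; _∷ʳ_; _[_]≔_; _[_]%=_)
import Data.Vec as Vec
open import Data.Vec.Properties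
  using (∷-injective; tabulate-cong; lookup∘tabulate; tabulate∘lookup; map-∘; map-cong; map-id; lookup-map;
         updateAt-commutes; updateAt-updateAt)
open import Data.Vec.Functional using (Vector; insertAt)
open import Data.Vec.Functional.Properties using (insertAt-lookup; insertAt-punchIn)
open import Data.List
  using (List; []; _∷_; _++_; map; concatMap; cartesianProductWith; allFin; length; filter; filterᵇ; foldr)
open import Data.List.Properties using (length-++; length-filter)
open import Data.List.Membership.Propositional using (_∈_)
open import Data.List.Membership.Propositional.Properties
  using (∈-∃++; ∈-++⁻; ∈-++⁺ˡ; ∈-++⁺ʳ; ∈-filter⁻; ∈-filter⁺; ∈-cartesianProductWith⁺; ∈-allFin)
open import Data.List.Relation.Unary.Any using (here; there)
import Data.List.Relation.Unary.All as All
open import Data.List.Relation.Unary.All.Properties using (all⁺; all⁻)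
open import Data.List.Relation.Unary.AllPairs using ([]; _∷_)
open import Data.List.Relation.Unary.Unique.Propositional using (Unique)
import Data.List.Relation.Unary.Unique.Propositional.Properties as Unique
open import Data.List.Relation.Binary.Sublist.Propositional using (⊆-refl)
open import Data.List.Relation.Binary.Sublist.Propositional.Properties using (filter⁺; length-mono-≤)
open import Data.Maybe using (Maybe; just; nothing)
import Data.Maybe as Maybe
open import Data.Product using (∃; ∃!; _×_; _,_; proj₁; proj₂)
open import Data.Sum using (_⊎_; inj₁; inj₂)
open import Function using (id; _∘_; _⇔_; mk⇔; Equivalence)
open import Level using (0ℓ)
open import Relation.Binary using (tri<; tri≈; tri>)
open import Relation.Binary.PropositionalEquality
  using (_≡_; _≢_; refl; sym; trans; cong; cong₂; subst; module ≡-Reasoning)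
open import Relation.Nullary using (¬_; Dec; yes; no; contradiction)
open import Relation.Nullary.Decidable using (T?; dec-true; dec-false)
open import Relation.Unary using (Pred; Decidable)
open import Relation.Unary.Properties using (_∩?_; ∁?)

open Equivalence

-- Counting in duplicate-free lists

module _ {A B : Set} (g : A → B) where

  length-≤-injection : ∀ {xs ys} → Unique xs →
    (∀ {x} → x ∈ xs → g x ∈ ys) →
    (∀ {x y} → x ∈ xs → y ∈ xs → g x ≡ g y → x ≡ y) →
    length xs ≤ length ys
  length-≤-injection {[]}     _              _    _   = z≤n
  length-≤-injection {x ∷ xs} (x≢xs ∷ uxs) into inj
    with as , bs , refl ← ∈-∃++ (into (here refl)) =
    subst (suc (length xs) ≤_) (sym length-middle)
      (s≤s (length-≤-injection uxs into′ λ p q → inj (there p) (there q)))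
    where
    length-middle : length (as ++ g x ∷ bs) ≡ suc (length (as ++ bs))
    length-middle rewrite length-++ as {g x ∷ bs} | length-++ as {bs} = ℕ.+-suc (length as) (length bs)
    into′ : ∀ {y} → y ∈ xs → g y ∈ as ++ bs
    into′ {y} y∈xs with ∈-++⁻ as (into (there y∈xs))
    ... | inj₁ p            = ∈-++⁺ˡ p
    ... | inj₂ (there p)    = ∈-++⁺ʳ as p
    ... | inj₂ (here gy≡gx) =
      contradiction (sym (inj (there y∈xs) (here refl) gy≡gx)) (All.lookup x≢xs y∈xs)

module _ {A : Set} {xs : List A} (xs-unique : Unique xs) where

  length-filter-disjoint : {P Q R : Pred A 0ℓ} (P? : Decidable P) (Q? : Decidable Q) (R? : Decidable R) →
    (∀ {x} → P x → R x) → (∀ {x} → Q x → R x) → (∀ {x} → P x → ¬ Q x) →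
    length (filter P? xs) + length (filter Q? xs) ≤ length (filter R? xs)
  length-filter-disjoint P? Q? R? P⊆R Q⊆R P∩Q=∅ =
    subst (_≤ length (filter R? xs)) (length-++ (filter P? xs))
      (length-≤-injection id
        (Unique.++⁺ (Unique.filter⁺ P? xs-unique) (Unique.filter⁺ Q? xs-unique)
          λ (p , q) → P∩Q=∅ (proj₂ (∈-filter⁻ P? {xs = xs} p)) (proj₂ (∈-filter⁻ Q? {xs = xs} q)))
        into (λ _ _ → id))
    where
    into : ∀ {x} → x ∈ filter P? xs ++ filter Q? xs → x ∈ filter R? xs
    into m with ∈-++⁻ (filter P? xs) m
    ... | inj₁ p = let x∈xs , px = ∈-filter⁻ P? {xs = xs} p in ∈-filter⁺ R? x∈xs (P⊆R px)
    ... | inj₂ q = let x∈xs , qx = ∈-filter⁻ Q? {xs = xs} q in ∈-filter⁺ R? x∈xs (Q⊆R qx)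

  length-filter-classes : ∀ {N a} {Q : Pred A 0ℓ} (C : Fin N → Pred A 0ℓ) →
    (C? : ∀ r → Decidable (C r)) (Q? : Decidable Q) →
    (∀ r {x} → C r x → Q x) → (∀ {r r′ x} → C r x → C r′ x → r ≡ r′) →
    (∀ r → a ≤ length (filter (C? r) xs)) →
    N * a ≤ length (filter Q? xs)
  length-filter-classes {zero}      C C? Q? C⊆Q disjoint a≤C = z≤n
  length-filter-classes {suc N} {a} C C? Q? C⊆Q disjoint a≤C =
    ℕ.≤-trans (ℕ.+-mono-≤ (a≤C zero) rest)
      (length-filter-disjoint (C? zero) (Q? ∩? ∁? (C? zero)) Q? (C⊆Q zero) proj₁
                              λ c₀ (_ , ¬c₀) → ¬c₀ c₀)
    where
    rest : N * a ≤ length (filter (Q? ∩? ∁? (C? zero)) xs)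
    rest = length-filter-classes (C ∘ suc) (C? ∘ suc) (Q? ∩? ∁? (C? zero))
      (λ r c → C⊆Q (suc r) c , λ c₀ → Fin.0≢1+n (disjoint c₀ c))
      (λ c c′ → Fin.suc-injective (disjoint c c′)) (a≤C ∘ suc)

concatMap≡cartesianProductWith : ∀ {A B C : Set} (g : A → B → C) (xs : List A) (ys : List B) →
  concatMap (λ x → map (g x) ys) xs ≡ cartesianProductWith g xs ys
concatMap≡cartesianProductWith g []       ys = refl
concatMap≡cartesianProductWith g (x ∷ xs) ys =
  cong (map (g x) ys ++_) (concatMap≡cartesianProductWith g xs ys)

module _ {A : Set} where

  vecsOver-suc : ∀ (xs : List A) l → vecsOver xs (suc l) ≡ cartesianProductWith _∷_ xs (vecsOver xs l)
  vecsOver-suc xs l = concatMap≡cartesianProductWith _∷_ xs (vecsOver xs l)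

  ∈-vecsOver : ∀ {xs : List A} → (∀ x → x ∈ xs) → ∀ {l} (v : Vec A l) → v ∈ vecsOver xs l
  ∈-vecsOver every []       = here refl
  ∈-vecsOver {xs} every {suc l} (x ∷ v) rewrite vecsOver-suc xs l =
    ∈-cartesianProductWith⁺ _∷_ (every x) (∈-vecsOver every v)

  vecsOver-unique : ∀ {xs : List A} → Unique xs → ∀ l → Unique (vecsOver xs l)
  vecsOver-unique u zero    = All.[] ∷ []
  vecsOver-unique {xs} u (suc l) rewrite vecsOver-suc xs l =
    Unique.cartesianProductWith⁺ _∷_ ∷-injective u (vecsOver-unique u l)

∈-allTensors : ∀ n d (A : Tensor n d) → A ∈ allTensors n d
∈-allTensors n zero    true  = here refl
∈-allTensors n zero    false = there (here refl)
∈-allTensors n (suc d) A     = ∈-vecsOver (∈-allTensors n d) A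

allTensors-unique : ∀ n d → Unique (allTensors n d)
allTensors-unique n zero    = ((λ ()) All.∷ All.[]) ∷ All.[] ∷ []
allTensors-unique n (suc d) = vecsOver-unique (allTensors-unique n d) n

∈-positions : ∀ {n d} (p : Vec (Fin n) d) → p ∈ positions n d
∈-positions = ∈-vecsOver ∈-allFin

L-unique : ∀ n k → Unique (L n k)
L-unique n k = Unique.filter⁺ (T? ∘ isPerm k) (allTensors-unique n (suc k))

module _ {X : Set} where

  all⇔ : (p : X → Bool) {xs : List X} → (∀ x → x ∈ xs) → T (all p xs) ⇔ (∀ x → T (p x))
  all⇔ p {xs} every = mk⇔ (λ h x → All.lookup (all⁺ p xs h) (every x))
                          (λ h → all⁻ p {xs = xs} (All.tabulate λ {x} _ → h x))

  indicator-sum : (g : X → Bool) (xs : List X) →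
    sum (map (λ x → if g x then 1 else 0) xs) ≡ length (filterᵇ g xs)
  indicator-sum g []       = refl
  indicator-sum g (x ∷ xs) with g x
  ... | true  = cong suc (indicator-sum g xs)
  ... | false = indicator-sum g xs

length-filterᵇ≡1⇔∃! : ∀ {n} (g : Fin n → Bool) →
  length (filterᵇ g (allFin n)) ≡ 1 ⇔ ∃! _≡_ (T ∘ g)
length-filterᵇ≡1⇔∃! {n} g = mk⇔ unique-member counted-once
  where
  unique-member : length (filterᵇ g (allFin n)) ≡ 1 → ∃! _≡_ (T ∘ g)
  unique-member length≡1 with filterᵇ g (allFin n) in eq
  unique-member ()   | []
  unique-member refl | t ∷ []    = t , proj₂ (∈-filter⁻ (T? ∘ g) {xs = allFin n} t∈) , unique
    where
    t∈ : t ∈ filterᵇ g (allFin n)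
    t∈ = subst (t ∈_) (sym eq) (here refl)
    unique : ∀ {s} → T (g s) → t ≡ s
    unique {s} gs with subst (s ∈_) eq (∈-filter⁺ (T? ∘ g) (∈-allFin s) gs)
    ... | here refl = refl
  unique-member ()   | _ ∷ _ ∷ _
  counted-once : ∃! _≡_ (T ∘ g) → length (filterᵇ g (allFin n)) ≡ 1
  counted-once (t , gt , unique) = ℕ.≤-antisym
    (length-≤-injection id {ys = t ∷ []} (Unique.filter⁺ (T? ∘ g) (Unique.allFin⁺ n))
      (λ s∈ → here (sym (unique (proj₂ (∈-filter⁻ (T? ∘ g) {xs = allFin n} s∈)))))
      λ _ _ → id)
    (length-≤-injection id {xs = t ∷ []} (All.[] ∷ [])
      (λ { (here refl) → ∈-filter⁺ (T? ∘ g) (∈-allFin t) gt }) λ _ _ → id)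

indicatorSum≡1⇔∃! : ∀ {n} (g : Fin n → Bool) →
  sum (map (λ t → if g t then 1 else 0) (allFin n)) ≡ 1 ⇔ ∃! _≡_ (T ∘ g)
indicatorSum≡1⇔∃! {n} g rewrite indicator-sum g (allFin n) = length-filterᵇ≡1⇔∃! g

IsPermutation : ∀ {n k} → Tensor n (suc k) → Set
IsPermutation {n} {k} A = ∀ (p : Vec (Fin n) (suc k)) j → ∃! _≡_ (λ t → T (at A (p [ j ]≔ t)))

isPerm⇔ : ∀ {n k} {A : Tensor n (suc k)} → T (isPerm k A) ⇔ IsPermutation A
isPerm⇔ {n} {k} {A} = mk⇔
  (λ h p j → line⇔ p j .to (ℕ.≡ᵇ⇒≡ _ 1 (all⇔ _ ∈-allFin .to (all⇔ _ ∈-positions .to h p) j)))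
  (λ h → all⇔ _ ∈-positions .from λ p → all⇔ _ ∈-allFin .from λ j →
           ℕ.≡⇒≡ᵇ _ 1 (line⇔ p j .from (h p j)))
  where
  line⇔ : ∀ p j → lineCount A p j ≡ 1 ⇔ ∃! _≡_ (λ t → T (at A (p [ j ]≔ t)))
  line⇔ p j = indicatorSum≡1⇔∃! (λ t → at A (p [ j ]≔ t))

∈-L⇔IsPermutation : ∀ {n k} {A : Tensor n (suc k)} → A ∈ L n k ⇔ IsPermutation A
∈-L⇔IsPermutation {n} {k} {A} = mk⇔
  (to isPerm⇔ ∘ proj₂ ∘ ∈-filter⁻ (T? ∘ isPerm k) {xs = allTensors n (suc k)})
  (∈-filter⁺ (T? ∘ isPerm k) (∈-allTensors n (suc k) A) ∘ from isPerm⇔)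

-- Relabelling the last coordinate

permute : ∀ {n d} → Permutation n n → Tensor n (suc d) → Tensor n (suc d)
permute {d = zero}  π A = tabulate (lookup A ∘ (π ⟨$⟩ˡ_))
permute {d = suc d} π A = Vec.map (permute π) A

at-permute : ∀ {n d} (π : Permutation n n) (A : Tensor n (suc d)) p →
  at (permute π A) p ≡ at A (p [ fromℕ d ]%= (π ⟨$⟩ˡ_))
at-permute {d = zero}  π A (t ∷ [])    = lookup∘tabulate (lookup A ∘ (π ⟨$⟩ˡ_)) t
at-permute {d = suc d} π A (i ∷ p) rewrite lookup-map i (permute π) A = at-permute π (lookup A i) p

permute-flip : ∀ {n d} (π : Permutation n n) (A : Tensor n (suc d)) →
  permute (flip π) (permute π A) ≡ A
permute-flip {d = zero}  π A = begin
  tabulate (lookup (tabulate (lookup A ∘ (π ⟨$⟩ˡ_))) ∘ (π ⟨$⟩ʳ_))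
    ≡⟨ tabulate-cong (λ t → trans (lookup∘tabulate _ (π ⟨$⟩ʳ t)) (cong (lookup A) (inverseˡ π))) ⟩
  tabulate (lookup A)
    ≡⟨ tabulate∘lookup A ⟩
  A ∎
  where open ≡-Reasoning
permute-flip {d = suc d} π A = begin
  Vec.map (permute (flip π)) (Vec.map (permute π) A) ≡⟨ map-∘ _ _ A ⟨
  Vec.map (permute (flip π) ∘ permute π) A           ≡⟨ map-cong (permute-flip π) A ⟩
  Vec.map id A                                       ≡⟨ map-id A ⟩
  A                                                  ∎
  where open ≡-Reasoning

permute-injective : ∀ {n d} (π : Permutation n n) {A B : Tensor n (suc d)} →
  permute π A ≡ permute π B → A ≡ B
permute-injective π {A} {B} eq = begin
  A                              ≡⟨ permute-flip π A ⟨
  permute (flip π) (permute π A) ≡⟨ cong (permute (flip π)) eq ⟩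
  permute (flip π) (permute π B) ≡⟨ permute-flip π B ⟩
  B ∎
  where open ≡-Reasoning

∃!-resp : ∀ {n} {g h : Fin n → Bool} → (∀ t → g t ≡ h t) →
  ∃! _≡_ (T ∘ g) → ∃! _≡_ (T ∘ h)
∃!-resp g≗h (t , gt , unique) = t , subst T (g≗h t) gt , λ ht → unique (subst T (sym (g≗h _)) ht)

∃!-permute : ∀ {n} (π : Permutation n n) {g : Fin n → Bool} →
  ∃! _≡_ (T ∘ g) → ∃! _≡_ (T ∘ g ∘ (π ⟨$⟩ˡ_))
∃!-permute π {g} (t , gt , unique) =
  π ⟨$⟩ʳ t , subst (T ∘ g) (sym (inverseˡ π)) gt ,
  λ gs → trans (cong (π ⟨$⟩ʳ_) (unique gs)) (inverseʳ π)

at-permute-along-last : ∀ {n d} (π : Permutation n n) (A : Tensor n (suc d)) p t →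
  at (permute π A) (p [ fromℕ d ]≔ t) ≡ at A (p [ fromℕ d ]≔ (π ⟨$⟩ˡ t))
at-permute-along-last {d = d} π A p t =
  trans (at-permute π A (p [ fromℕ d ]≔ t)) (cong (at A) (updateAt-updateAt (fromℕ d) p))

at-permute-across : ∀ {n d} (π : Permutation n n) (A : Tensor n (suc d)) p {j} → j ≢ fromℕ d → ∀ t →
  at (permute π A) (p [ j ]≔ t) ≡ at A ((p [ fromℕ d ]%= (π ⟨$⟩ˡ_)) [ j ]≔ t)
at-permute-across {d = d} π A p {j} j≢last t =
  trans (at-permute π A (p [ j ]≔ t)) (cong (at A) (updateAt-commutes (fromℕ d) j (j≢last ∘ sym) p))

permute-isPermutation : ∀ {n d} (π : Permutation n n) {A : Tensor n (suc d)} →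
  IsPermutation A → IsPermutation (permute π A)
permute-isPermutation {d = d} π {A} pA p j with j ≟ fromℕ d
... | yes refl  = ∃!-resp (sym ∘ at-permute-along-last π A p) (∃!-permute π (pA p j))
... | no j≢last = ∃!-resp (sym ∘ at-permute-across π A p j≢last) (pA (p [ fromℕ d ]%= (π ⟨$⟩ˡ_)) j)

∷ʳ-updateAt-last : ∀ {X : Set} {k} (β : Vec X k) (s : X) (g : X → X) →
  (β ∷ʳ s) [ fromℕ k ]%= g ≡ β ∷ʳ g s
∷ʳ-updateAt-last []      s g = refl
∷ʳ-updateAt-last (b ∷ β) s g = cong (b ∷_) (∷ʳ-updateAt-last β s g)

-- f A β unfolds to firstTrue (λ t → at A (β ∷ʳ t)) (allFin n).

module _ {X : Set} (g : X → Bool) where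

  firstTrue : List X → Maybe X
  firstTrue = foldr (λ t r → if g t then just t else r) nothing

  firstTrue-sound : ∀ xs {t} → firstTrue xs ≡ just t → T (g t)
  firstTrue-sound (x ∷ xs) eq with g x in gx
  firstTrue-sound (x ∷ xs) refl | true = subst T (sym gx) _
  ... | false = firstTrue-sound xs eq

  firstTrue-nothing : ∀ {xs t} → firstTrue xs ≡ nothing → t ∈ xs → ¬ T (g t)
  firstTrue-nothing {x ∷ xs} eq t∈ with g x in gx
  firstTrue-nothing {x ∷ xs} eq (here refl) | false = subst T gx
  firstTrue-nothing {x ∷ xs} eq (there t∈) | false = firstTrue-nothing eq t∈

module _ {n k} {A : Tensor n (suc k)} (pA : IsPermutation A) (β : Vec (Fin n) k) where

  column-unique : ∀ {s t} → T (at A (β ∷ʳ s)) → T (at A (β ∷ʳ t)) → s ≡ t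
  column-unique {s} {t} As At with pA (β ∷ʳ s) (fromℕ k)
  ... | _ , _ , unique = trans (sym (unique (on-line As))) (unique (on-line At))
    where
    on-line : ∀ {u} → T (at A (β ∷ʳ u)) → T (at A ((β ∷ʳ s) [ fromℕ k ]≔ u))
    on-line {u} = subst (T ∘ at A) (sym (∷ʳ-updateAt-last β s (λ _ → u)))

  f-unique : ∀ {t} → T (at A (β ∷ʳ t)) → f A β ≡ just t
  f-unique {t} At with f A β in eq
  ... | just s  = cong just (column-unique (firstTrue-sound (λ u → at A (β ∷ʳ u)) (allFin n) eq) At)
  ... | nothing = contradiction At (firstTrue-nothing (λ u → at A (β ∷ʳ u)) eq (∈-allFin t))

at-permute-column : ∀ {n k} (π : Permutation n n) (A : Tensor n (suc k)) β s →
  at (permute π A) (β ∷ʳ s) ≡ at A (β ∷ʳ (π ⟨$⟩ˡ s))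
at-permute-column π A β s =
  trans (at-permute π A (β ∷ʳ s)) (cong (at A) (∷ʳ-updateAt-last β s (π ⟨$⟩ˡ_)))

f-permute : ∀ {n k} (π : Permutation n n) {A : Tensor n (suc k)} → IsPermutation A → ∀ β →
  f (permute π A) β ≡ Maybe.map (π ⟨$⟩ʳ_) (f A β)
f-permute {n} π {A} pA β with f A β in eq
... | just t  =
  f-unique (permute-isPermutation π pA) β (subst T (sym moved) (firstTrue-sound _ (allFin n) eq))
  where
  moved : at (permute π A) (β ∷ʳ (π ⟨$⟩ʳ t)) ≡ at A (β ∷ʳ t)
  moved = trans (at-permute-column π A β (π ⟨$⟩ʳ t)) (cong (λ u → at A (β ∷ʳ u)) (inverseˡ π))
... | nothing with f (permute π A) β in eq′
...   | nothing = refl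
...   | just s  = contradiction
                    (subst T (at-permute-column π A β s) (firstTrue-sound _ (allFin n) eq′))
                    (firstTrue-nothing (λ u → at A (β ∷ʳ u)) eq (∈-allFin (π ⟨$⟩ˡ s)))

ltM-irrefl : ∀ {n} (x : Maybe (Fin n)) → ¬ T (ltM x x)
ltM-irrefl (just a) lt = ℕ.<-irrefl refl (ℕ.<ᵇ⇒< (toℕ a) (toℕ a) lt)

ltM-asym : ∀ {n} {x y : Maybe (Fin n)} → T (ltM x y) → ¬ T (ltM y x)
ltM-asym {x = just a} {just b} lt gt =
  ℕ.<-asym (ℕ.<ᵇ⇒< (toℕ a) (toℕ b) lt) (ℕ.<ᵇ⇒< (toℕ b) (toℕ a) gt)

ltM-justˡ : ∀ {n} {x y : Maybe (Fin n)} → T (ltM x y) → ∃ λ a → x ≡ just a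
ltM-justˡ {x = just a} {just _} _ = a , refl

ltM-justʳ : ∀ {n} {x y : Maybe (Fin n)} → T (ltM x y) → ∃ λ b → y ≡ just b
ltM-justʳ {x = just _} {just b} _ = b , refl

values : ∀ {n k m} → Tensor n (suc k) → (Fin m → Vec (Fin n) k) → Fin m → Maybe (Fin n)
values A γ i = f A (γ i)

Sorted : ∀ {n m} → (Fin m → Maybe (Fin n)) → Set
Sorted v = ∀ i j → i < j → T (ltM (v i) (v j))

increasing⇔Sorted : ∀ {n k m} (γ : Fin m → Vec (Fin n) k) (A : Tensor n (suc k)) →
  T (increasing γ A) ⇔ Sorted (values A γ)
increasing⇔Sorted {m = m} γ A = mk⇔ sorted sorted⁻¹
  where
  pair : Fin m → Fin m → Bool
  pair i j = if toℕ i <ᵇ toℕ j then ltM (values A γ i) (values A γ j) else true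
  row : Fin m → Bool
  row i = all (pair i) (allFin m)
  if-true : ∀ {b x} → T b → T (if b then x else true) → T x
  if-true {true} _ h = h
  sorted : T (increasing γ A) → Sorted (values A γ)
  sorted h i j i<j =
    if-true (ℕ.<⇒<ᵇ i<j) (to (all⇔ (pair i) ∈-allFin) (to (all⇔ row ∈-allFin) h i) j)
  ordered : Sorted (values A γ) → ∀ i j → T (pair i j)
  ordered s i j with toℕ i <ᵇ toℕ j in i<ᵇj
  ... | true  = s i j (ℕ.<ᵇ⇒< (toℕ i) (toℕ j) (subst T (sym i<ᵇj) tt))
  ... | false = tt
  sorted⁻¹ : Sorted (values A γ) → T (increasing γ A)
  sorted⁻¹ s = from (all⇔ row ∈-allFin) λ i → from (all⇔ (pair i) ∈-allFin) (ordered s i)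

module _ {n m} {v : Fin m → Maybe (Fin n)} (sorted : Sorted v) where

  sorted-compare : ∀ {i j} → i ≢ j → T (ltM (v i) (v j)) ⊎ T (ltM (v j) (v i))
  sorted-compare {i} {j} i≢j with Fin.<-cmp i j
  ... | tri< i<j _ _ = inj₁ (sorted i j i<j)
  ... | tri≈ _ i≡j _ = contradiction i≡j i≢j
  ... | tri> _ _ j<i = inj₂ (sorted j i j<i)

  sorted-just : ∀ {i j} → i ≢ j → ∃ λ a → v i ≡ just a
  sorted-just {i} {j} i≢j with sorted-compare i≢j
  ... | inj₁ lt = ltM-justˡ {y = v j} lt
  ... | inj₂ gt = ltM-justʳ {x = v j} gt

  sorted-injective : ∀ {i j} → i ≢ j → v i ≢ v j
  sorted-injective {i} {j} i≢j vi≡vj with sorted-compare i≢j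
  ... | inj₁ lt = ltM-irrefl (v j) (subst (λ x → T (ltM x (v j))) vi≡vj lt)
  ... | inj₂ gt = ltM-irrefl (v j) (subst (λ x → T (ltM (v j) x)) vi≡vj gt)

sorted-resp : ∀ {n m} {v w : Fin m → Maybe (Fin n)} → (∀ i → v i ≡ w i) → Sorted v → Sorted w
sorted-resp v≗w sorted i j = subst T (cong₂ ltM (v≗w i) (v≗w j)) ∘ sorted i j

sorted-∘ : ∀ {n m m′} {v : Fin m → Maybe (Fin n)} {g : Fin m′ → Fin m} →
  (∀ {i j} → i < j → g i < g j) → Sorted v → Sorted (v ∘ g)
sorted-∘ {g = g} g-mono sorted i j = sorted (g i) (g j) ∘ g-mono

count : ∀ {n k} → (Tensor n (suc k) → Bool) → ℕ
count {n} {k} p = length (filterᵇ p (L n k))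

∈-increasing⇔ : ∀ {n k m} {γ : Fin m → Vec (Fin n) k} {A : Tensor n (suc k)} →
  A ∈ filterᵇ (increasing γ) (L n k) ⇔ (IsPermutation A × Sorted (values A γ))
∈-increasing⇔ {n} {k} {γ = γ} {A} = mk⇔
  (λ A∈ → let A∈L , incr = ∈-filter⁻ (T? ∘ increasing γ) {xs = L n k} A∈
          in to ∈-L⇔IsPermutation A∈L , to (increasing⇔Sorted γ A) incr)
  (λ h → ∈-filter⁺ (T? ∘ increasing γ) (from ∈-L⇔IsPermutation (proj₁ h))
                    (from (increasing⇔Sorted γ A) (proj₂ h)))

-- Exchanging two positions

transpose-matchˡ : ∀ {n} (a b : Fin n) → PC.transpose a b a ≡ b
transpose-matchˡ a b rewrite dec-true (a ≟ a) refl = refl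

transpose-matchʳ : ∀ {n} (a b : Fin n) → PC.transpose a b b ≡ a
transpose-matchʳ a b with b ≟ a
... | yes b≡a = b≡a
... | no  _   rewrite dec-true (b ≟ b) refl = refl

transpose-other : ∀ {n} {a b c : Fin n} → c ≢ a → c ≢ b → PC.transpose a b c ≡ c
transpose-other {a = a} {b} {c} c≢a c≢b
  rewrite dec-false (c ≟ a) c≢a | dec-false (c ≟ b) c≢b = refl

transpose-swaps-values : ∀ {n m} {v : Fin m → Maybe (Fin n)} →
  (∀ {l l′} → l ≢ l′ → v l ≢ v l′) →
  ∀ {i j a b} → v i ≡ just a → v j ≡ just b →
  ∀ l → Maybe.map (PC.transpose a b) (v (PC.transpose i j l)) ≡ v l
transpose-swaps-values {n} {v = v} distinct {i} {j} {a} {b} vi vj l = by-cases (l ≟ i) (l ≟ j)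
  where
  open ≡-Reasoning
  τ : Fin n → Fin n
  τ = PC.transpose a b
  moved : ∀ {l′ x y} → PC.transpose i j l ≡ l′ → v l′ ≡ just y → τ y ≡ x → v l ≡ just x →
    Maybe.map τ (v (PC.transpose i j l)) ≡ v l
  moved {l′} {x} {y} τl≡l′ vl′ τy≡x vl = begin
    Maybe.map τ (v (PC.transpose i j l)) ≡⟨ cong (Maybe.map τ ∘ v) τl≡l′ ⟩
    Maybe.map τ (v l′)                   ≡⟨ cong (Maybe.map τ) vl′ ⟩
    just (τ y)                           ≡⟨ cong just τy≡x ⟩
    just x                               ≡⟨ vl ⟨
    v l                                  ∎
  fixed : l ≢ i → l ≢ j → ∀ x → v l ≡ x → Maybe.map τ x ≡ x
  fixed l≢i l≢j nothing  _  = refl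
  fixed l≢i l≢j (just c) vl = cong just (transpose-other (other l≢i vi) (other l≢j vj))
    where
    other : ∀ {i′ c′} → l ≢ i′ → v i′ ≡ just c′ → c ≢ c′
    other l≢i′ vi′ refl = distinct l≢i′ (trans vl (sym vi′))
  by-cases : Dec (l ≡ i) → Dec (l ≡ j) → Maybe.map τ (v (PC.transpose i j l)) ≡ v l
  by-cases (yes refl) _          = moved (transpose-matchˡ i j) vj (transpose-matchʳ a b) vi
  by-cases (no _)     (yes refl) = moved (transpose-matchʳ i j) vi (transpose-matchˡ a b) vj
  by-cases (no l≢i)   (no l≢j)   =
    trans (cong (Maybe.map τ ∘ v) (transpose-other l≢i l≢j)) (fixed l≢i l≢j (v l) refl)

-- Junk value idₚ when a value is missing; swapValues only meets sorted sequences, where both exist.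
transposeᴹ : ∀ {n} → Maybe (Fin n) → Maybe (Fin n) → Permutation n n
transposeᴹ (just a) (just b) = transpose a b
transposeᴹ _        _        = idₚ

module _ {n k m} (γ : Fin m → Vec (Fin n) k) {i j : Fin m} (i≢j : i ≢ j) where

  swapValues : Tensor n (suc k) → Tensor n (suc k)
  swapValues A = permute (transposeᴹ (f A (γ i)) (f A (γ j))) A

  values-swapValues : ∀ {A} → IsPermutation A → Sorted (values A γ) →
    ∀ l → values (swapValues A) γ (PC.transpose i j l) ≡ values A γ l
  values-swapValues {A} pA sorted l
    with a , fAγi ← sorted-just {v = values A γ} sorted i≢j
       | b , fAγj ← sorted-just {v = values A γ} sorted (i≢j ∘ sym) = begin
    f (swapValues A) (γ (PC.transpose i j l))
      ≡⟨ cong (λ π → f (permute π A) (γ (PC.transpose i j l))) (cong₂ transposeᴹ fAγi fAγj) ⟩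
    f (permute (transpose a b) A) (γ (PC.transpose i j l))
      ≡⟨ f-permute (transpose a b) pA (γ (PC.transpose i j l)) ⟩
    Maybe.map (PC.transpose a b) (f A (γ (PC.transpose i j l)))
      ≡⟨ transpose-swaps-values (sorted-injective {v = values A γ} sorted) fAγi fAγj l ⟩
    f A (γ l) ∎
    where open ≡-Reasoning

  swapValues-injective : ∀ {A B} → IsPermutation A → Sorted (values A γ) →
    IsPermutation B → Sorted (values B γ) →
    swapValues A ≡ swapValues B → A ≡ B
  swapValues-injective {A} {B} pA sA pB sB eq =
    permute-injective _
      (trans eq (cong (λ π → permute π B) (sym (cong₂ transposeᴹ (same i) (same j)))))
    where
    same : ∀ l → f A (γ l) ≡ f B (γ l)
    same l = trans (sym (values-swapValues pA sA l))
                   (trans (cong (λ C → values C γ (PC.transpose i j l)) eq) (values-swapValues pB sB l))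

  count-increasing-transpose : (γ′ : Fin m → Vec (Fin n) k) →
    (∀ l → γ′ l ≡ γ (PC.transpose i j l)) →
    count (increasing γ) ≤ count (increasing γ′)
  count-increasing-transpose γ′ γ′≗γ∘τ =
    length-≤-injection swapValues (Unique.filter⁺ (T? ∘ increasing γ) (L-unique n k)) into injective
    where
    into : ∀ {A} → A ∈ filterᵇ (increasing γ) (L n k) →
      swapValues A ∈ filterᵇ (increasing γ′) (L n k)
    into A∈ with pA , sA ← to (∈-increasing⇔ {γ = γ}) A∈ =
      from (∈-increasing⇔ {γ = γ′}) (permute-isPermutation _ pA ,
        sorted-resp (λ l → sym (trans (cong (f (swapValues _)) (γ′≗γ∘τ l)) (values-swapValues pA sA l)))
                    sA)
    injective : ∀ {A B} →
      A ∈ filterᵇ (increasing γ) (L n k) → B ∈ filterᵇ (increasing γ) (L n k) →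
      swapValues A ≡ swapValues B → A ≡ B
    injective A∈ B∈
      with pA , sA ← to (∈-increasing⇔ {γ = γ}) A∈
         | pB , sB ← to (∈-increasing⇔ {γ = γ}) B∈ =
      swapValues-injective pA sA pB sB

-- Moving the first position

insertAt-head-tail : ∀ {X : Set} {m} (α : Fin (suc m) → X) l →
  insertAt (α ∘ suc) zero (α zero) l ≡ α l
insertAt-head-tail α zero    = refl
insertAt-head-tail α (suc l) = refl

insertAt-suc : ∀ {X : Set} {m} (xs : Vector X m) (r : Fin m) (x : X) l →
  insertAt xs (suc r) x l ≡ insertAt xs (inject₁ r) x (PC.transpose (inject₁ r) (suc r) l)
insertAt-suc {m = suc m} xs zero    x zero          = refl
insertAt-suc {m = suc m} xs zero    x (suc zero)    = refl
insertAt-suc {m = suc m} xs zero    x (suc (suc l)) = refl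
insertAt-suc {m = suc m} xs (suc r) x zero          = refl
insertAt-suc {m = suc m} xs (suc r) x (suc l)       =
  trans (insertAt-suc (xs ∘ suc) r x l)
        (cong (insertAt xs (suc (inject₁ r)) x) (sym (lift₀-transpose (inject₁ r) (suc r) (suc l))))

punchIn-mono-< : ∀ {m} (i : Fin (suc m)) {j k : Fin m} → j < k → punchIn i j < punchIn i k
punchIn-mono-< zero    j<k = s≤s j<k
punchIn-mono-< (suc i) {zero}  {suc k} j<k       = s≤s z≤n
punchIn-mono-< (suc i) {suc j} {suc k} (s≤s j<k) = s≤s (punchIn-mono-< i j<k)

punchIn-below : ∀ {m} (i : Fin (suc m)) {j : Fin m} → j < i → punchIn i j < i
punchIn-below (suc i) {zero}  j<i       = s≤s z≤n
punchIn-below (suc i) {suc j} (s≤s j<i) = s≤s (punchIn-below i j<i)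

punchIn-above : ∀ {m} (i : Fin (suc m)) {j : Fin m} → toℕ i ≤ toℕ j → i < punchIn i j
punchIn-above zero    _         = s≤s z≤n
punchIn-above (suc i) {suc j} (s≤s i≤j) = s≤s (punchIn-above i i≤j)

module _ {X : Set} {n m} (F : X → Maybe (Fin n)) (xs : Vector X m) (x : X) where

  module _ {r : Fin (suc m)} (sorted : Sorted (F ∘ insertAt xs r x)) where

    sorted-insertAt⁻ : Sorted (F ∘ xs)
    sorted-insertAt⁻ =
      sorted-resp (cong F ∘ insertAt-punchIn xs r x)
                  (sorted-∘ {v = F ∘ insertAt xs r x} (punchIn-mono-< r) sorted)

    sorted-insertAt-below : ∀ {i} → i < r → T (ltM (F (xs i)) (F x))
    sorted-insertAt-below {i} i<r =
      subst T (cong₂ ltM (cong F (insertAt-punchIn xs r x i)) (cong F (insertAt-lookup xs r x)))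
              (sorted _ _ (punchIn-below r i<r))

    sorted-insertAt-above : ∀ {i} → toℕ r ≤ toℕ i → T (ltM (F x) (F (xs i)))
    sorted-insertAt-above {i} r≤i =
      subst T (cong₂ ltM (cong F (insertAt-lookup xs r x)) (cong F (insertAt-punchIn xs r x i)))
              (sorted _ _ (punchIn-above r r≤i))

  sorted-insertAt-<⇒⊥ : ∀ {r r′} → r < r′ →
    Sorted (F ∘ insertAt xs r x) → Sorted (F ∘ insertAt xs r′ x) → ⊥
  sorted-insertAt-<⇒⊥ {r} {r′} r<r′ sorted sorted′ =
    ltM-asym {x = F x} (sorted-insertAt-above sorted (ℕ.≤-reflexive (sym toℕi≡r)))
             (sorted-insertAt-below sorted′ (subst (_<ℕ toℕ r′) (sym toℕi≡r) r<r′))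
    where
    r<m : toℕ r <ℕ m
    r<m = ℕ.≤-trans r<r′ (Fin.toℕ≤pred[n] r′)
    toℕi≡r : toℕ (fromℕ< r<m) ≡ toℕ r
    toℕi≡r = Fin.toℕ-fromℕ< r<m

  sorted-insertAt-unique : ∀ {r r′} →
    Sorted (F ∘ insertAt xs r x) → Sorted (F ∘ insertAt xs r′ x) → r ≡ r′
  sorted-insertAt-unique {r} {r′} sorted sorted′ with Fin.<-cmp r r′
  ... | tri< r<r′ _ _ = ⊥-elim (sorted-insertAt-<⇒⊥ r<r′ sorted sorted′)
  ... | tri≈ _ r≡r′ _ = r≡r′
  ... | tri> _ _ r′<r = ⊥-elim (sorted-insertAt-<⇒⊥ r′<r sorted′ sorted)

count-mono : ∀ {n k} {p q : Tensor n (suc k) → Bool} → (∀ {A} → T (p A) → T (q A)) →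
  count p ≤ count q
count-mono {n} {k} {p} {q} p⇒q =
  length-mono-≤ (filter⁺ (T? ∘ p) (T? ∘ q) (λ { refl → p⇒q }) (⊆-refl {x = L n k}))

module _ {n k m} (α : Fin (suc m) → Vec (Fin n) k) where

  headAt : Fin (suc m) → Fin (suc m) → Vec (Fin n) k
  headAt r = insertAt (α ∘ suc) r (α zero)

  count-increasing-≤-headAt : ∀ r → count (increasing α) ≤ count (increasing (headAt r))
  count-increasing-≤-headAt = <-weakInduction (λ r → count (increasing α) ≤ count (increasing (headAt r)))
    base step
    where
    base : count (increasing α) ≤ count (increasing (headAt zero))
    base = count-mono λ {A} → from (increasing⇔Sorted (headAt zero) A)
                            ∘ sorted-resp (λ l → cong (f A) (sym (insertAt-head-tail α l)))
                            ∘ to (increasing⇔Sorted α A)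
    inject₁≢suc : ∀ {m} (r : Fin m) → inject₁ r ≢ suc r
    inject₁≢suc r eq = ℕ.1+n≢n (trans (sym (cong toℕ eq)) (Fin.toℕ-inject₁ r))
    step : ∀ r → count (increasing α) ≤ count (increasing (headAt (inject₁ r))) →
      count (increasing α) ≤ count (increasing (headAt (suc r)))
    step r ih = ℕ.≤-trans ih (count-increasing-transpose (headAt (inject₁ r)) (inject₁≢suc r) (headAt (suc r))
                                                         (insertAt-suc (α ∘ suc) r (α zero)))

  suc*count-increasing≤tail : suc m * count (increasing α) ≤ count (increasing (α ∘ suc))
  suc*count-increasing≤tail =
    length-filter-classes (L-unique n k) (λ r A → T (increasing (headAt r) A))
      (λ r → T? ∘ increasing (headAt r)) (T? ∘ increasing (α ∘ suc))
      (λ r {A} → from (increasing⇔Sorted (α ∘ suc) A)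
               ∘ sorted-insertAt⁻ (f A) (α ∘ suc) (α zero) {r}
               ∘ to (increasing⇔Sorted (headAt r) A))
      (λ {r} {r′} {A} c c′ → sorted-insertAt-unique (f A) (α ∘ suc) (α zero)
                               (to (increasing⇔Sorted (headAt r) A) c)
                               (to (increasing⇔Sorted (headAt r′) A) c′))
      count-increasing-≤-headAt

count-increasing*!≤length-L : ∀ {n k} m (α : Fin m → Vec (Fin n) k) →
  count (increasing α) * m ! ≤ length (L n k)
count-increasing*!≤length-L {n} {k} zero    α =
  ℕ.≤-trans (ℕ.≤-reflexive (ℕ.*-identityʳ _)) (length-filter (T? ∘ increasing α) (L n k))
count-increasing*!≤length-L {n} {k} (suc m) α = begin
  count (increasing α) * (suc m * m !) ≡⟨ ℕ.*-assoc (count (increasing α)) (suc m) (m !) ⟨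
  count (increasing α) * suc m * m !   ≡⟨ cong (_* m !) (ℕ.*-comm (count (increasing α)) (suc m)) ⟩
  suc m * count (increasing α) * m !   ≤⟨ ℕ.*-monoˡ-≤ (m !) (suc*count-increasing≤tail α) ⟩
  count (increasing (α ∘ suc)) * m !   ≤⟨ count-increasing*!≤length-L m (α ∘ suc) ⟩
  length (L n k)                       ∎
  where open ℕ.≤-Reasoning

corollary15 : (n k m : ℕ) (α : Fin m → Vec (Fin n) k) →
    (∀ i j → α i ≡ α j → i ≡ j) →
    length (filterᵇ (increasing α) (L n k)) * m ! ≤ length (L n k)
corollary15 n k m α _ = count-increasing*!≤length-L m α
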